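{- Let $D$ be a dendriform algebra over a field $k$ of characteristic zero and $\overline D=D\oplus k\mathbf 1$ its unital augmentation. Let $b,c\in D$ and let $Y,Z\in\overline D[[\lambda]]$ satisfy $$Y=\mathbf 1+\lambda\, c\prec Y,\qquad Z=\mathbf 1+\lambda\, Z\succ b .$$ Then for every $a\in D$ the element $$X:=Y*\bigl(Y^{ -1}\succ a\prec Z^{ -1}\bigr)*Z$$ satisfies $$X=a+\lambda\, X\succ b+\lambda\, c\prec X .$$
   Context: A dendriform algebra over $k$ is a $k$-vector space $D$ with bilinear operations $\prec,\succ$ such that for all $a,b,c\in D$: $(a\prec b)\prec c=a\prec(b\prec c+b\succ c)$, $(a\succ b)\prec c=a\succ(b\prec c)$, $a\succ(b\succ c)=(a\prec b+a\succ b)\succ c$. The product $a*b:=a\prec b+a\succ b$ is associative. The augmentation $\overline D=D\oplus k\mathbf 1$ is defined by $a\prec\mathbf 1=a=\mathbf 1\succ a$ and $\mathbf 1\prec a=0=a\succ\mathbf 1$ for $a\in D$ ($\mathbf 1\prec\mathbf 1$, $\mathbf 1\succ\mathbf 1$ undefined), with $\mathbf 1*\mathbf 1=\mathbf 1$. Operations are extended $\lambda$-bilinearly to $\overline D[[\lambda]]$. For $W$ with constant term $\mathbf 1$, $W^{ -1}$ is its $*$-inverse. The expression $Y^{ -1}\succ a\prec Z^{ -1}$ means $(Y^{ -1}\succ a)\prec Z^{ -1}=Y^{ -1}\succ(a\prec Z^{ -1})$. -}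

module Defs where

open import Level using (Level; _⊔_) renaming (suc to lsuc)
open import Algebra.Bundles using (CommutativeRing)
open import Algebra.Module.Bundles using (Module)
open import Data.Nat using (ℕ; zero; suc; _∸_)
open import Data.Product using (_×_; _,_; ∃)
open import Relation.Nullary using (¬_)

record Field (c ℓ : Level) : Set (lsuc (c ⊔ ℓ)) where
  field
    commutativeRing : CommutativeRing c ℓ
  open CommutativeRing commutativeRing public
  field
    0≉1     : ¬ (0# ≈ 1#)
    inverse : ∀ x → ¬ (x ≈ 0#) → ∃ λ y → (x * y) ≈ 1#

  ofℕ : ℕ → Carrier
  ofℕ zero    = 0#
  ofℕ (suc n) = 1# + ofℕ n

CharZero : ∀ {c ℓ} → Field c ℓ → Set ℓ
CharZero F = ∀ n → ¬ (ofℕ (suc n) ≈ 0#)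
  where open Field F

record Dendriform {c ℓ} (F : Field c ℓ) (m ℓm : Level) : Set (c ⊔ ℓ ⊔ lsuc (m ⊔ ℓm)) where
  open Field F
  field
    vectorSpace : Module commutativeRing m ℓm
  open Module vectorSpace public
  infixl 7 _≺_ _≻_
  field
    _≺_ _≻_ : Carrierᴹ → Carrierᴹ → Carrierᴹ
    ≺-cong : ∀ {x x' y y'} → x ≈ᴹ x' → y ≈ᴹ y' → (x ≺ y) ≈ᴹ (x' ≺ y')
    ≻-cong : ∀ {x x' y y'} → x ≈ᴹ x' → y ≈ᴹ y' → (x ≻ y) ≈ᴹ (x' ≻ y')
    ≺-+ˡ : ∀ x y z → ((x +ᴹ y) ≺ z) ≈ᴹ ((x ≺ z) +ᴹ (y ≺ z))
    ≺-+ʳ : ∀ x y z → (z ≺ (x +ᴹ y)) ≈ᴹ ((z ≺ x) +ᴹ (z ≺ y))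
    ≻-+ˡ : ∀ x y z → ((x +ᴹ y) ≻ z) ≈ᴹ ((x ≻ z) +ᴹ (y ≻ z))
    ≻-+ʳ : ∀ x y z → (z ≻ (x +ᴹ y)) ≈ᴹ ((z ≻ x) +ᴹ (z ≻ y))
    ≺-*ˡ : ∀ r x y → ((r *ₗ x) ≺ y) ≈ᴹ (r *ₗ (x ≺ y))
    ≺-*ʳ : ∀ r x y → (x ≺ (r *ₗ y)) ≈ᴹ (r *ₗ (x ≺ y))
    ≻-*ˡ : ∀ r x y → ((r *ₗ x) ≻ y) ≈ᴹ (r *ₗ (x ≻ y))
    ≻-*ʳ : ∀ r x y → (x ≻ (r *ₗ y)) ≈ᴹ (r *ₗ (x ≻ y))
    dend₁ : ∀ a b c → ((a ≺ b) ≺ c) ≈ᴹ (a ≺ ((b ≺ c) +ᴹ (b ≻ c)))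
    dend₂ : ∀ a b c → ((a ≻ b) ≺ c) ≈ᴹ (a ≻ (b ≺ c))
    dend₃ : ∀ a b c → (a ≻ (b ≻ c)) ≈ᴹ (((a ≺ b) +ᴹ (a ≻ b)) ≻ c)

  _∗_ : Carrierᴹ → Carrierᴹ → Carrierᴹ
  x ∗ y = (x ≺ y) +ᴹ (x ≻ y)

sumTo : ∀ {a} {A : Set a} → (A → A → A) → (ℕ → A) → ℕ → A
sumTo _+_ h zero    = h zero
sumTo _+_ h (suc n) = sumTo _+_ h n + h (suc n)

conv : ∀ {a b d} {A : Set a} {B : Set b} {C : Set d} →
       (C → C → C) → (A → B → C) → (ℕ → A) → (ℕ → B) → ℕ → C
conv _+_ op f g n = sumTo _+_ (λ i → op (f i) (g (n ∸ i))) n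

-- multiplication by λ (shift), given the zero coefficient
shiftWith : ∀ {a} {A : Set a} → A → (ℕ → A) → ℕ → A
shiftWith z f zero    = z
shiftWith z f (suc n) = f n

constWith : ∀ {a} {A : Set a} → A → A → ℕ → A
constWith z x zero    = x
constWith z x (suc n) = z

module Ops {c ℓ m ℓm} {F : Field c ℓ} (D : Dendriform F m ℓm) where
  open Field F
  open Dendriform D

  -- an element (x , α) of D̄ stands for x + α·1
  D̄ : Set (m ⊔ c)
  D̄ = Carrierᴹ × Carrier

  _≈̄_ : D̄ → D̄ → Set (ℓm ⊔ ℓ)
  (x , α) ≈̄ (y , β) = (x ≈ᴹ y) × (α ≈ β)

  _+̄_ : D̄ → D̄ → D̄
  (x , α) +̄ (y , β) = (x +ᴹ y , α + β)

  0̄ 1̄ : D̄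
  0̄ = (0ᴹ , 0#)
  1̄ = (0ᴹ , 1#)

  -- (x + α1) * (y + β1) = x*y + α y + β x + αβ 1
  -- (using x*1 = x ≺ 1 + x ≻ 1 = x and 1*y = 1 ≺ y + 1 ≻ y = y)
  _∗̄_ : D̄ → D̄ → D̄
  (x , α) ∗̄ (y , β) = (((x ∗ y) +ᴹ (α *ₗ y)) +ᴹ (β *ₗ x) , α * β)

  -- (x + α1) ≻ a = x ≻ a + α a      (1 ≻ a = a)
  _≻̄_ : D̄ → Carrierᴹ → Carrierᴹ
  (x , α) ≻̄ a = (x ≻ a) +ᴹ (α *ₗ a)

  -- a ≺ (x + α1) = a ≺ x + α a      (a ≺ 1 = a)
  _≺̄_ : Carrierᴹ → D̄ → Carrierᴹ
  a ≺̄ (x , α) = (a ≺ x) +ᴹ (α *ₗ a)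

  -- formal power series in λ
  PS : Set m
  PS = ℕ → Carrierᴹ
  PS̄ : Set (m ⊔ c)
  PS̄ = ℕ → D̄

  _≋_ : PS → PS → Set ℓm
  f ≋ g = ∀ n → f n ≈ᴹ g n
  _≋̄_ : PS̄ → PS̄ → Set (ℓm ⊔ ℓ)
  f ≋̄ g = ∀ n → f n ≈̄ g n

  _⊕_ : PS → PS → PS
  (f ⊕ g) n = f n +ᴹ g n
  _⊕̄_ : PS̄ → PS̄ → PS̄
  (f ⊕̄ g) n = f n +̄ g n

  ι : PS → PS̄
  ι f n = (f n , 0#)

  cst : Carrierᴹ → PS
  cst = constWith 0ᴹ
  one : PS̄
  one = constWith 0̄ 1̄

  lam : PS → PS
  lam = shiftWith 0ᴹ
  lam̄ : PS̄ → PS̄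
  lam̄ = shiftWith 0̄

  -- λ-bilinear extensions of *, ≻, ≺
  _⊛_ : PS̄ → PS̄ → PS̄
  _⊛_ = conv _+̄_ _∗̄_
  _⊱_ : PS̄ → PS → PS
  _⊱_ = conv _+ᴹ_ _≻̄_
  _⊰_ : PS → PS̄ → PS
  _⊰_ = conv _+ᴹ_ _≺̄_

  IsInverse : PS̄ → PS̄ → Set (ℓm ⊔ ℓ)
  IsInverse W V = ((W ⊛ V) ≋̄ one) × ((V ⊛ W) ≋̄ one)

-- The D-part of X = (Y * (Y⁻¹ ≻ a ≺ Z⁻¹)) * Z splits, by x * y = x ≺ y + x ≻ y, into
--   ((Y - 1) ≺ W) ≺ Z  +  (Y ≻ W) ≺ Z  +  (Y * W) ≻ (Z - 1),     W = Y⁻¹ ≻ a ≺ Z⁻¹.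
-- The dendriform axioms say that ≻ and ≺ are left and right actions of the associative
-- algebra (D̄[[λ]], *) commuting with each other, so the middle term collapses to a by
-- Y * Y⁻¹ = 1 = Z⁻¹ * Z, while Y - 1 = λ c ≺ Y and Z - 1 = λ Z ≻ b turn the outer terms
-- into λ c ≺ X and λ X ≻ b.
module Submission where

open import Defs
open import Level using (Level)
open import Algebra.Bundles using (CommutativeMonoid)
open import Data.Nat using (ℕ; zero; suc; _∸_; _≤_; z≤n)
open import Data.Nat.Properties using (≤-refl; m≤n⇒m≤1+n; +-∸-assoc; n∸n≡0)
open import Data.Product using (_,_; proj₁; proj₂)
open import Relation.Binary.Bundles using (Setoid)
open import Relation.Binary.PropositionalEquality using (cong)
import Algebra.Properties.CommutativeSemigroup as CommutativeSemigroupProperties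
import Relation.Binary.Reasoning.Setoid as SetoidReasoning

module CauchyProducts {c ℓ} (M : CommutativeMonoid c ℓ) where
  open CommutativeMonoid M renaming (Carrier to C)
  open CommutativeSemigroupProperties commutativeSemigroup using (interchange)
  open SetoidReasoning setoid

  private variable
    a : Level
    A B E AB BC : Set a

  Σ : (ℕ → C) → ℕ → C
  Σ = sumTo _∙_

  Σ-cong : ∀ {f g} n → (∀ i → i ≤ n → f i ≈ g i) → Σ f n ≈ Σ g n
  Σ-cong zero    f≈g = f≈g 0 z≤n
  Σ-cong (suc n) f≈g = ∙-cong (Σ-cong n (λ i i≤n → f≈g i (m≤n⇒m≤1+n i≤n))) (f≈g (suc n) ≤-refl)

  Σ-distrib : ∀ f g n → Σ (λ i → f i ∙ g i) n ≈ Σ f n ∙ Σ g n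
  Σ-distrib f g zero    = refl
  Σ-distrib f g (suc n) = trans (∙-congʳ (Σ-distrib f g n)) (interchange _ _ _ _)

  Σ-ε : ∀ f n → (∀ i → i ≤ n → f i ≈ ε) → Σ f n ≈ ε
  Σ-ε f n f≈ε = trans (Σ-cong n f≈ε) (Σ-const-ε n)
    where
    Σ-const-ε : ∀ n → Σ (λ _ → ε) n ≈ ε
    Σ-const-ε zero    = refl
    Σ-const-ε (suc n) = trans (∙-congʳ (Σ-const-ε n)) (identityˡ ε)

  Σ-suc : ∀ f n → Σ f (suc n) ≈ f 0 ∙ Σ (λ i → f (suc i)) n
  Σ-suc f zero    = refl
  Σ-suc f (suc n) = trans (∙-congʳ (Σ-suc f n)) (assoc _ _ _)

  Σ-antidiagonal-suc : ∀ (H : ℕ → ℕ → C) n →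
    Σ (λ i → H i (suc n ∸ i)) (suc n) ≈ Σ (λ i → H i (suc (n ∸ i))) n ∙ H (suc n) 0
  Σ-antidiagonal-suc H n =
    ∙-cong (Σ-cong n (λ i i≤n → reflexive (cong (H i) (+-∸-assoc 1 i≤n))))
           (reflexive (cong (H (suc n)) (n∸n≡0 n)))

  Σ-homomorphic : (_+_ : A → A → A) (φ : A → C) → (∀ x y → φ (x + y) ≈ φ x ∙ φ y) →
    ∀ f n → φ (sumTo _+_ f n) ≈ Σ (λ i → φ (f i)) n
  Σ-homomorphic _+_ φ φ-+ f zero    = refl
  Σ-homomorphic _+_ φ φ-+ f (suc n) = trans (φ-+ _ _) (∙-congʳ (Σ-homomorphic _+_ φ φ-+ f n))

  -- Both sides sum G j k l over all j + k + l = n.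
  Σ-triangle : ∀ (G : ℕ → ℕ → ℕ → C) n →
    Σ (λ i → Σ (λ j → G j (i ∸ j) (n ∸ i)) i) n ≈ Σ (λ j → Σ (λ k → G j k (n ∸ j ∸ k)) (n ∸ j)) n
  Σ-triangle G zero    = refl
  Σ-triangle G (suc n) = begin
      Σ (λ i → Σ (λ j → G j (i ∸ j) (suc n ∸ i)) i) (suc n)
    ≈⟨ Σ-antidiagonal-suc (λ i l → Σ (λ j → G j (i ∸ j) l) i) n ⟩
      Σ (λ i → Σ (λ j → G⁺ j (i ∸ j) (n ∸ i)) i) n ∙ Σ (λ j → G j (suc n ∸ j) 0) (suc n)
    ≈⟨ ∙-cong (Σ-triangle G⁺ n) (Σ-antidiagonal-suc (λ j k → G j k 0) n) ⟩
      Σ (λ j → Σ (λ k → G⁺ j k (n ∸ j ∸ k)) (n ∸ j)) n ∙ (Σ last n ∙ G (suc n) 0 0)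
    ≈⟨ assoc _ _ _ ⟨
      (Σ (λ j → Σ (λ k → G⁺ j k (n ∸ j ∸ k)) (n ∸ j)) n ∙ Σ last n) ∙ G (suc n) 0 0
    ≈⟨ ∙-congʳ (Σ-distrib _ _ n) ⟨
      Σ (λ j → Σ (λ k → G⁺ j k (n ∸ j ∸ k)) (n ∸ j) ∙ last j) n ∙ G (suc n) 0 0
    ≈⟨ ∙-congʳ (Σ-cong n (λ j _ → Σ-antidiagonal-suc (G j) (n ∸ j))) ⟨
      Σ (λ j → Σ (λ k → G j k (suc (n ∸ j) ∸ k)) (suc (n ∸ j))) n ∙ G (suc n) 0 0
    ≈⟨ Σ-antidiagonal-suc (λ j m → Σ (λ k → G j k (m ∸ k)) m) n ⟨
      Σ (λ j → Σ (λ k → G j k (suc n ∸ j ∸ k)) (suc n ∸ j)) (suc n) ∎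
    where
    G⁺ : ℕ → ℕ → ℕ → C
    G⁺ j k l = G j k (suc l)
    last : ℕ → C
    last j = G j (suc (n ∸ j)) 0

  module _ (op : A → B → C) where

    conv-shiftˡ : ∀ z f g → (∀ y → op z y ≈ ε) →
      ∀ n → shiftWith ε (conv _∙_ op f g) n ≈ conv _∙_ op (shiftWith z f) g n
    conv-shiftˡ z f g z-op zero    = sym (z-op _)
    conv-shiftˡ z f g z-op (suc n) = sym (trans (Σ-suc _ n) (trans (∙-congʳ (z-op _)) (identityˡ _)))

    conv-shiftʳ : ∀ z f g → (∀ x → op x z ≈ ε) →
      ∀ n → shiftWith ε (conv _∙_ op f g) n ≈ conv _∙_ op f (shiftWith z g) n
    conv-shiftʳ z f g op-z zero    = sym (op-z _)
    conv-shiftʳ z f g op-z (suc n) = sym (begin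
        Σ (λ i → op (f i) (shiftWith z g (suc n ∸ i))) (suc n)
      ≈⟨ Σ-antidiagonal-suc (λ i k → op (f i) (shiftWith z g k)) n ⟩
        Σ (λ i → op (f i) (g (n ∸ i))) n ∙ op (f (suc n)) z
      ≈⟨ ∙-congˡ (op-z _) ⟩
        Σ (λ i → op (f i) (g (n ∸ i))) n ∙ ε
      ≈⟨ identityʳ _ ⟩
        Σ (λ i → op (f i) (g (n ∸ i))) n ∎)

    conv-constˡ : ∀ z u g → (∀ y → op z y ≈ ε) → ∀ n → conv _∙_ op (constWith z u) g n ≈ op u (g n)
    conv-constˡ z u g z-op zero    = refl
    conv-constˡ z u g z-op (suc n) =
      trans (Σ-suc _ n) (trans (∙-congˡ (Σ-ε _ n (λ _ _ → z-op _))) (identityʳ _))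

    conv-constʳ : ∀ z u f → (∀ x → op x z ≈ ε) → ∀ n → conv _∙_ op f (constWith z u) n ≈ op (f n) u
    conv-constʳ z u f op-z zero    = refl
    conv-constʳ z u f op-z (suc n) = begin
        Σ (λ i → op (f i) (constWith z u (suc n ∸ i))) (suc n)
      ≈⟨ Σ-antidiagonal-suc (λ i k → op (f i) (constWith z u k)) n ⟩
        Σ (λ i → op (f i) z) n ∙ op (f (suc n)) u
      ≈⟨ ∙-congʳ (Σ-ε _ n (λ _ _ → op-z _)) ⟩
        ε ∙ op (f (suc n)) u
      ≈⟨ identityˡ _ ⟩
        op (f (suc n)) u ∎

  conv-assoc : (_+₁_ : AB → AB → AB) (_+₂_ : BC → BC → BC)
    (op₁ : AB → E → C) (op₂ : A → B → AB) (op₃ : A → BC → C) (op₄ : B → E → BC) →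
    (∀ x y z → op₁ (x +₁ y) z ≈ op₁ x z ∙ op₁ y z) →
    (∀ x y z → op₃ x (y +₂ z) ≈ op₃ x y ∙ op₃ x z) →
    (∀ x y z → op₁ (op₂ x y) z ≈ op₃ x (op₄ y z)) →
    ∀ f g h n → conv _∙_ op₁ (conv _+₁_ op₂ f g) h n ≈ conv _∙_ op₃ f (conv _+₂_ op₄ g h) n
  conv-assoc _+₁_ _+₂_ op₁ op₂ op₃ op₄ op₁-+ op₃-+ op-assoc f g h n = begin
      conv _∙_ op₁ (conv _+₁_ op₂ f g) h n
    ≈⟨ Σ-cong n (λ i _ → Σ-homomorphic _+₁_ (λ x → op₁ x (h (n ∸ i))) (λ x y → op₁-+ x y _) _ i) ⟩
      Σ (λ i → Σ (λ j → op₁ (op₂ (f j) (g (i ∸ j))) (h (n ∸ i))) i) n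
    ≈⟨ Σ-cong n (λ i _ → Σ-cong i (λ j _ → op-assoc _ _ _)) ⟩
      Σ (λ i → Σ (λ j → G j (i ∸ j) (n ∸ i)) i) n
    ≈⟨ Σ-triangle G n ⟩
      Σ (λ j → Σ (λ k → G j k (n ∸ j ∸ k)) (n ∸ j)) n
    ≈⟨ Σ-cong n (λ j _ → Σ-homomorphic _+₂_ (op₃ (f j)) (op₃-+ _) _ (n ∸ j)) ⟨
      conv _∙_ op₃ f (conv _+₂_ op₄ g h) n ∎
    where
    G : ℕ → ℕ → ℕ → C
    G j k l = op₃ (f j) (op₄ (g k) (h l))

module Augmentation {κ ℓ m ℓm} {F : Field κ ℓ} (D : Dendriform F m ℓm) where
  open Field F
  open Dendriform D
  open Ops D
  open CommutativeSemigroupProperties (CommutativeMonoid.commutativeSemigroup +ᴹ-commutativeMonoid)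
    using (interchange; xy∙z≈xz∙y)
  open SetoidReasoning ≈ᴹ-setoid

  homogeneous⇒zero : (φ : Carrierᴹ → Carrierᴹ) → (∀ {x y} → x ≈ᴹ y → φ x ≈ᴹ φ y) →
    (∀ r x → φ (r *ₗ x) ≈ᴹ r *ₗ φ x) → φ 0ᴹ ≈ᴹ 0ᴹ
  homogeneous⇒zero φ φ-cong φ-*ₗ = begin
    φ 0ᴹ            ≈⟨ φ-cong (*ₗ-zeroˡ 0ᴹ) ⟨
    φ (0# *ₗ 0ᴹ)    ≈⟨ φ-*ₗ 0# 0ᴹ ⟩
    0# *ₗ φ 0ᴹ      ≈⟨ *ₗ-zeroˡ _ ⟩
    0ᴹ              ∎

  ≻-zeroˡ : ∀ x → 0ᴹ ≻ x ≈ᴹ 0ᴹ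
  ≻-zeroˡ x = homogeneous⇒zero (_≻ x) (λ e → ≻-cong e ≈ᴹ-refl) (λ r y → ≻-*ˡ r y x)

  ≻-zeroʳ : ∀ x → x ≻ 0ᴹ ≈ᴹ 0ᴹ
  ≻-zeroʳ x = homogeneous⇒zero (x ≻_) (≻-cong ≈ᴹ-refl) (λ r y → ≻-*ʳ r x y)

  ≺-zeroˡ : ∀ x → 0ᴹ ≺ x ≈ᴹ 0ᴹ
  ≺-zeroˡ x = homogeneous⇒zero (_≺ x) (λ e → ≺-cong e ≈ᴹ-refl) (λ r y → ≺-*ˡ r y x)

  ≺-zeroʳ : ∀ x → x ≺ 0ᴹ ≈ᴹ 0ᴹ
  ≺-zeroʳ x = homogeneous⇒zero (x ≺_) (≺-cong ≈ᴹ-refl) (λ r y → ≺-*ʳ r x y)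

  ≻̄-zeroˡ : ∀ x → 0̄ ≻̄ x ≈ᴹ 0ᴹ
  ≻̄-zeroˡ x = ≈ᴹ-trans (+ᴹ-cong (≻-zeroˡ x) (*ₗ-zeroˡ x)) (+ᴹ-identityˡ 0ᴹ)

  ≻̄-zeroʳ : ∀ s → s ≻̄ 0ᴹ ≈ᴹ 0ᴹ
  ≻̄-zeroʳ (x , α) = ≈ᴹ-trans (+ᴹ-cong (≻-zeroʳ x) (*ₗ-zeroʳ α)) (+ᴹ-identityˡ 0ᴹ)

  ≺̄-zeroˡ : ∀ s → 0ᴹ ≺̄ s ≈ᴹ 0ᴹ
  ≺̄-zeroˡ (x , α) = ≈ᴹ-trans (+ᴹ-cong (≺-zeroˡ x) (*ₗ-zeroʳ α)) (+ᴹ-identityˡ 0ᴹ)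

  ≺̄-zeroʳ : ∀ x → x ≺̄ 0̄ ≈ᴹ 0ᴹ
  ≺̄-zeroʳ x = ≈ᴹ-trans (+ᴹ-cong (≺-zeroʳ x) (*ₗ-zeroˡ x)) (+ᴹ-identityˡ 0ᴹ)

  ≻̄-identityˡ : ∀ x → 1̄ ≻̄ x ≈ᴹ x
  ≻̄-identityˡ x = ≈ᴹ-trans (+ᴹ-cong (≻-zeroˡ x) (*ₗ-identityˡ x)) (+ᴹ-identityˡ x)

  ≺̄-identityʳ : ∀ x → x ≺̄ 1̄ ≈ᴹ x
  ≺̄-identityʳ x = ≈ᴹ-trans (+ᴹ-cong (≺-zeroʳ x) (*ₗ-identityˡ x)) (+ᴹ-identityˡ x)

  ≻̄-cong : ∀ {s s' x x'} → s ≈̄ s' → x ≈ᴹ x' → s ≻̄ x ≈ᴹ s' ≻̄ x'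
  ≻̄-cong (x≈ , α≈) e = +ᴹ-cong (≻-cong x≈ e) (*ₗ-cong α≈ e)

  ≺̄-cong : ∀ {x x' s s'} → x ≈ᴹ x' → s ≈̄ s' → x ≺̄ s ≈ᴹ x' ≺̄ s'
  ≺̄-cong e (x≈ , α≈) = +ᴹ-cong (≺-cong e x≈) (*ₗ-cong α≈ e)

  ≻̄-+ˡ : ∀ s t x → (s +̄ t) ≻̄ x ≈ᴹ (s ≻̄ x) +ᴹ (t ≻̄ x)
  ≻̄-+ˡ (y , α) (z , β) x = ≈ᴹ-trans (+ᴹ-cong (≻-+ˡ y z x) (*ₗ-distribʳ x α β)) (interchange _ _ _ _)

  ≻̄-+ʳ : ∀ s x y → s ≻̄ (x +ᴹ y) ≈ᴹ (s ≻̄ x) +ᴹ (s ≻̄ y)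
  ≻̄-+ʳ (z , α) x y = ≈ᴹ-trans (+ᴹ-cong (≻-+ʳ x y z) (*ₗ-distribˡ α x y)) (interchange _ _ _ _)

  ≺̄-+ˡ : ∀ x y s → (x +ᴹ y) ≺̄ s ≈ᴹ (x ≺̄ s) +ᴹ (y ≺̄ s)
  ≺̄-+ˡ x y (z , α) = ≈ᴹ-trans (+ᴹ-cong (≺-+ˡ x y z) (*ₗ-distribˡ α x y)) (interchange _ _ _ _)

  ≺̄-+ʳ : ∀ x s t → x ≺̄ (s +̄ t) ≈ᴹ (x ≺̄ s) +ᴹ (x ≺̄ t)
  ≺̄-+ʳ x (y , α) (z , β) = ≈ᴹ-trans (+ᴹ-cong (≺-+ʳ y z x) (*ₗ-distribʳ x α β)) (interchange _ _ _ _)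

  proj₁-∗̄ : ∀ s t → proj₁ (s ∗̄ t) ≈ᴹ (proj₁ s ≺̄ t) +ᴹ (s ≻̄ proj₁ t)
  proj₁-∗̄ (x , α) (y , β) = ≈ᴹ-trans (+ᴹ-congʳ (+ᴹ-assoc _ _ _)) (xy∙z≈xz∙y _ _ _)

  dend₁̄ : ∀ x s t → (x ≺̄ s) ≺̄ t ≈ᴹ x ≺̄ (s ∗̄ t)
  dend₁̄ x (y , α) (z , β) = begin
      (((x ≺ y) +ᴹ (α *ₗ x)) ≺ z) +ᴹ (β *ₗ ((x ≺ y) +ᴹ (α *ₗ x)))
    ≈⟨ +ᴹ-cong (≈ᴹ-trans (≺-+ˡ _ _ z) (+ᴹ-congˡ (≺-*ˡ α x z))) (*ₗ-distribˡ β _ _) ⟩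
      (((x ≺ y) ≺ z) +ᴹ (α *ₗ (x ≺ z))) +ᴹ ((β *ₗ (x ≺ y)) +ᴹ (β *ₗ (α *ₗ x)))
    ≈⟨ +ᴹ-cong (+ᴹ-congʳ (dend₁ x y z)) (+ᴹ-congˡ (≈ᴹ-trans (*ₗ-comm β α x) (≈ᴹ-sym (*ₗ-assoc α β x)))) ⟩
      ((x ≺ (y ∗ z)) +ᴹ (α *ₗ (x ≺ z))) +ᴹ ((β *ₗ (x ≺ y)) +ᴹ ((α * β) *ₗ x))
    ≈⟨ +ᴹ-assoc _ _ _ ⟨
      (((x ≺ (y ∗ z)) +ᴹ (α *ₗ (x ≺ z))) +ᴹ (β *ₗ (x ≺ y))) +ᴹ ((α * β) *ₗ x)
    ≈⟨ +ᴹ-congʳ (≈ᴹ-trans (≺-+ʳ _ _ x) (+ᴹ-cong (≈ᴹ-trans (≺-+ʳ _ _ x) (+ᴹ-congˡ (≺-*ʳ α x z))) (≺-*ʳ β x y))) ⟨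
      (x ≺ (((y ∗ z) +ᴹ (α *ₗ z)) +ᴹ (β *ₗ y))) +ᴹ ((α * β) *ₗ x)
    ∎

  dend₂̄ : ∀ s x t → (s ≻̄ x) ≺̄ t ≈ᴹ s ≻̄ (x ≺̄ t)
  dend₂̄ (y , α) x (z , β) = begin
      (((y ≻ x) +ᴹ (α *ₗ x)) ≺ z) +ᴹ (β *ₗ ((y ≻ x) +ᴹ (α *ₗ x)))
    ≈⟨ +ᴹ-cong (≈ᴹ-trans (≺-+ˡ _ _ z) (+ᴹ-congˡ (≺-*ˡ α x z))) (*ₗ-distribˡ β _ _) ⟩
      (((y ≻ x) ≺ z) +ᴹ (α *ₗ (x ≺ z))) +ᴹ ((β *ₗ (y ≻ x)) +ᴹ (β *ₗ (α *ₗ x)))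
    ≈⟨ interchange _ _ _ _ ⟩
      (((y ≻ x) ≺ z) +ᴹ (β *ₗ (y ≻ x))) +ᴹ ((α *ₗ (x ≺ z)) +ᴹ (β *ₗ (α *ₗ x)))
    ≈⟨ +ᴹ-cong (+ᴹ-congʳ (dend₂ y x z)) (+ᴹ-congˡ (*ₗ-comm β α x)) ⟩
      ((y ≻ (x ≺ z)) +ᴹ (β *ₗ (y ≻ x))) +ᴹ ((α *ₗ (x ≺ z)) +ᴹ (α *ₗ (β *ₗ x)))
    ≈⟨ +ᴹ-cong (≈ᴹ-trans (≻-+ʳ _ _ y) (+ᴹ-congˡ (≻-*ʳ β y x))) (*ₗ-distribˡ α _ _) ⟨
      (y ≻ ((x ≺ z) +ᴹ (β *ₗ x))) +ᴹ (α *ₗ ((x ≺ z) +ᴹ (β *ₗ x)))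
    ∎

  dend₃̄ : ∀ s t x → (s ∗̄ t) ≻̄ x ≈ᴹ s ≻̄ (t ≻̄ x)
  dend₃̄ (y , α) (z , β) x = begin
      ((((y ∗ z) +ᴹ (α *ₗ z)) +ᴹ (β *ₗ y)) ≻ x) +ᴹ ((α * β) *ₗ x)
    ≈⟨ +ᴹ-congʳ (≈ᴹ-trans (≻-+ˡ _ _ x) (+ᴹ-cong (≈ᴹ-trans (≻-+ˡ _ _ x) (+ᴹ-congˡ (≻-*ˡ α z x))) (≻-*ˡ β y x))) ⟩
      ((((y ∗ z) ≻ x) +ᴹ (α *ₗ (z ≻ x))) +ᴹ (β *ₗ (y ≻ x))) +ᴹ ((α * β) *ₗ x)
    ≈⟨ +ᴹ-assoc _ _ _ ⟩
      (((y ∗ z) ≻ x) +ᴹ (α *ₗ (z ≻ x))) +ᴹ ((β *ₗ (y ≻ x)) +ᴹ ((α * β) *ₗ x))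
    ≈⟨ interchange _ _ _ _ ⟩
      (((y ∗ z) ≻ x) +ᴹ (β *ₗ (y ≻ x))) +ᴹ ((α *ₗ (z ≻ x)) +ᴹ ((α * β) *ₗ x))
    ≈⟨ +ᴹ-cong (+ᴹ-congʳ (≈ᴹ-sym (dend₃ y z x))) (+ᴹ-congˡ (*ₗ-assoc α β x)) ⟩
      ((y ≻ (z ≻ x)) +ᴹ (β *ₗ (y ≻ x))) +ᴹ ((α *ₗ (z ≻ x)) +ᴹ (α *ₗ (β *ₗ x)))
    ≈⟨ +ᴹ-cong (≈ᴹ-trans (≻-+ʳ _ _ y) (+ᴹ-congˡ (≻-*ʳ β y x))) (*ₗ-distribˡ α _ _) ⟨
      (y ≻ ((z ≻ x) +ᴹ (β *ₗ x))) +ᴹ (α *ₗ ((z ≻ x) +ᴹ (β *ₗ x)))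
    ∎

module PowerSeries {κ ℓ m ℓm} {F : Field κ ℓ} (D : Dendriform F m ℓm) where
  open Field F hiding (zero)
  open Dendriform D
  open Ops D
  open Augmentation D
  open CommutativeSemigroupProperties (CommutativeMonoid.commutativeSemigroup +ᴹ-commutativeMonoid)
    using (xy∙z≈yz∙x)
  private
    module ΣD = CauchyProducts +ᴹ-commutativeMonoid
    module Σk = CauchyProducts +-commutativeMonoid

  ≋-setoid : Setoid m ℓm
  ≋-setoid = record
    { Carrier       = PS
    ; _≈_           = _≋_
    ; isEquivalence = record
      { refl  = λ _ → ≈ᴹ-refl
      ; sym   = λ f≋g n → ≈ᴹ-sym (f≋g n)
      ; trans = λ f≋g g≋h n → ≈ᴹ-trans (f≋g n) (g≋h n)
      }
    }

  open SetoidReasoning ≋-setoid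

  dPart : PS̄ → PS
  dPart S n = proj₁ (S n)

  kPart : PS̄ → ℕ → Carrier
  kPart S n = proj₂ (S n)

  UnitFree : PS̄ → Set ℓ
  UnitFree S = ∀ n → kPart S n ≈ 0#

  ⊕-cong : ∀ {f f' g g'} → f ≋ f' → g ≋ g' → (f ⊕ g) ≋ (f' ⊕ g')
  ⊕-cong f≋ g≋ n = +ᴹ-cong (f≋ n) (g≋ n)

  lam-cong : ∀ {f g} → f ≋ g → lam f ≋ lam g
  lam-cong f≋g zero    = ≈ᴹ-refl
  lam-cong f≋g (suc n) = f≋g n

  ⊱-congˡ : ∀ {S S'} f → S ≋̄ S' → (S ⊱ f) ≋ (S' ⊱ f)
  ⊱-congˡ f S≋S' n = ΣD.Σ-cong n (λ i _ → ≻̄-cong (S≋S' i) ≈ᴹ-refl)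

  ⊱-congʳ : ∀ S {f f'} → f ≋ f' → (S ⊱ f) ≋ (S ⊱ f')
  ⊱-congʳ S f≋f' n = ΣD.Σ-cong n (λ i _ → ≻̄-cong (≈ᴹ-refl , refl) (f≋f' (n ∸ i)))

  ⊰-congˡ : ∀ {f f'} S → f ≋ f' → (f ⊰ S) ≋ (f' ⊰ S)
  ⊰-congˡ S f≋f' n = ΣD.Σ-cong n (λ i _ → ≺̄-cong (f≋f' i) (≈ᴹ-refl , refl))

  ⊰-congʳ : ∀ f {S S'} → S ≋̄ S' → (f ⊰ S) ≋ (f ⊰ S')
  ⊰-congʳ f S≋S' n = ΣD.Σ-cong n (λ i _ → ≺̄-cong ≈ᴹ-refl (S≋S' (n ∸ i)))

  ⊰-distribʳ : ∀ f g S → ((f ⊕ g) ⊰ S) ≋ ((f ⊰ S) ⊕ (g ⊰ S))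
  ⊰-distribʳ f g S n =
    ≈ᴹ-trans (ΣD.Σ-cong n (λ i _ → ≺̄-+ˡ (f i) (g i) (S (n ∸ i)))) (ΣD.Σ-distrib _ _ n)

  dPart-⊛ : ∀ S T → dPart (S ⊛ T) ≋ ((dPart S ⊰ T) ⊕ (S ⊱ dPart T))
  dPart-⊛ S T n = ≈ᴹ-trans (ΣD.Σ-homomorphic _+̄_ proj₁ (λ _ _ → ≈ᴹ-refl) _ n)
    (≈ᴹ-trans (ΣD.Σ-cong n (λ i _ → proj₁-∗̄ (S i) (T (n ∸ i)))) (ΣD.Σ-distrib _ _ n))

  kPart-⊛ : ∀ S T n → kPart (S ⊛ T) n ≈ conv _+_ _*_ (kPart S) (kPart T) n
  kPart-⊛ S T n = Σk.Σ-homomorphic _+̄_ proj₂ (λ _ _ → refl) _ n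

  ⊛-unitFreeˡ : ∀ S T → UnitFree S → UnitFree (S ⊛ T)
  ⊛-unitFreeˡ S T S-free n =
    trans (kPart-⊛ S T n) (Σk.Σ-ε _ n (λ i _ → trans (*-congʳ (S-free i)) (zeroˡ _)))

  ⊛-unitFreeʳ : ∀ S T → UnitFree T → UnitFree (S ⊛ T)
  ⊛-unitFreeʳ S T T-free n =
    trans (kPart-⊛ S T n) (Σk.Σ-ε _ n (λ i _ → trans (*-congˡ (T-free (n ∸ i))) (zeroʳ _)))

  dPart-one+lam : ∀ {S} g → S ≋̄ (one ⊕̄ lam̄ (ι g)) → dPart S ≋ lam g
  dPart-one+lam g S≈ zero    = ≈ᴹ-trans (proj₁ (S≈ zero)) (+ᴹ-identityˡ _)
  dPart-one+lam g S≈ (suc n) = ≈ᴹ-trans (proj₁ (S≈ (suc n))) (+ᴹ-identityˡ _)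

  ⊛-⊱-assoc : ∀ S T f → ((S ⊛ T) ⊱ f) ≋ (S ⊱ (T ⊱ f))
  ⊛-⊱-assoc = ΣD.conv-assoc _+̄_ _+ᴹ_ _≻̄_ _∗̄_ _≻̄_ _≻̄_ ≻̄-+ˡ ≻̄-+ʳ dend₃̄

  ⊰-⊛-assoc : ∀ f S T → ((f ⊰ S) ⊰ T) ≋ (f ⊰ (S ⊛ T))
  ⊰-⊛-assoc = ΣD.conv-assoc _+ᴹ_ _+̄_ _≺̄_ _≺̄_ _≺̄_ _∗̄_ ≺̄-+ˡ ≺̄-+ʳ dend₁̄

  ⊱-⊰-assoc : ∀ S f T → ((S ⊱ f) ⊰ T) ≋ (S ⊱ (f ⊰ T))
  ⊱-⊰-assoc = ΣD.conv-assoc _+ᴹ_ _+ᴹ_ _≺̄_ _≻̄_ _≻̄_ _≺̄_ ≺̄-+ˡ ≻̄-+ʳ dend₂̄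

  one-⊱ : ∀ f → (one ⊱ f) ≋ f
  one-⊱ f n = ≈ᴹ-trans (ΣD.conv-constˡ _≻̄_ 0̄ 1̄ f ≻̄-zeroˡ n) (≻̄-identityˡ (f n))

  ⊰-one : ∀ f → (f ⊰ one) ≋ f
  ⊰-one f n = ≈ᴹ-trans (ΣD.conv-constʳ _≺̄_ 0̄ 1̄ f ≺̄-zeroʳ n) (≺̄-identityʳ (f n))

  lam-⊱ : ∀ S f → lam (S ⊱ f) ≋ (S ⊱ lam f)
  lam-⊱ S f = ΣD.conv-shiftʳ _≻̄_ 0ᴹ S f ≻̄-zeroʳ

  lam-⊰ : ∀ f S → lam (f ⊰ S) ≋ (lam f ⊰ S)
  lam-⊰ f S = ΣD.conv-shiftˡ _≺̄_ 0ᴹ f S ≺̄-zeroˡ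

  ⊱-cancel : ∀ S T → (S ⊛ T) ≋̄ one → ∀ f → (S ⊱ (T ⊱ f)) ≋ f
  ⊱-cancel S T ST≈1 f = begin
    S ⊱ (T ⊱ f)  ≈⟨ ⊛-⊱-assoc S T f ⟨
    (S ⊛ T) ⊱ f  ≈⟨ ⊱-congˡ f ST≈1 ⟩
    one ⊱ f      ≈⟨ one-⊱ f ⟩
    f            ∎

  ⊰-cancel : ∀ S T → (S ⊛ T) ≋̄ one → ∀ f → ((f ⊰ S) ⊰ T) ≋ f
  ⊰-cancel S T ST≈1 f = begin
    (f ⊰ S) ⊰ T  ≈⟨ ⊰-⊛-assoc f S T ⟩
    f ⊰ (S ⊛ T)  ≈⟨ ⊰-congʳ f ST≈1 ⟩
    f ⊰ one      ≈⟨ ⊰-one f ⟩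
    f            ∎

  conjugate-cancel : ∀ Y Y⁻¹ Z Z⁻¹ → (Y ⊛ Y⁻¹) ≋̄ one → (Z⁻¹ ⊛ Z) ≋̄ one →
    ∀ f → ((Y ⊱ ((Y⁻¹ ⊱ f) ⊰ Z⁻¹)) ⊰ Z) ≋ f
  conjugate-cancel Y Y⁻¹ Z Z⁻¹ YY⁻¹≈1 Z⁻¹Z≈1 f = begin
    (Y ⊱ ((Y⁻¹ ⊱ f) ⊰ Z⁻¹)) ⊰ Z  ≈⟨ ⊰-congˡ Z (⊱-⊰-assoc Y (Y⁻¹ ⊱ f) Z⁻¹) ⟨
    ((Y ⊱ (Y⁻¹ ⊱ f)) ⊰ Z⁻¹) ⊰ Z  ≈⟨ ⊰-congˡ Z (⊰-congˡ Z⁻¹ (⊱-cancel Y Y⁻¹ YY⁻¹≈1 f)) ⟩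
    (f ⊰ Z⁻¹) ⊰ Z                ≈⟨ ⊰-cancel Z⁻¹ Z Z⁻¹Z≈1 f ⟩
    f                            ∎

  lam-⊰-⊛ : ∀ g S T → (lam (g ⊰ S) ⊰ T) ≋ lam (g ⊰ (S ⊛ T))
  lam-⊰-⊛ g S T = begin
    lam (g ⊰ S) ⊰ T    ≈⟨ lam-⊰ (g ⊰ S) T ⟨
    lam ((g ⊰ S) ⊰ T)  ≈⟨ lam-cong (⊰-⊛-assoc g S T) ⟩
    lam (g ⊰ (S ⊛ T))  ∎

  ⊱-lam-⊛ : ∀ S T g → (S ⊱ lam (T ⊱ g)) ≋ lam ((S ⊛ T) ⊱ g)
  ⊱-lam-⊛ S T g = begin
    S ⊱ lam (T ⊱ g)    ≈⟨ lam-⊱ S (T ⊱ g) ⟨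
    lam (S ⊱ (T ⊱ g))  ≈⟨ lam-cong (⊛-⊱-assoc S T g) ⟨
    lam ((S ⊛ T) ⊱ g)  ∎

  sandwich-fixpoint : ∀ Y Z b c W → dPart Y ≋ lam (cst c ⊰ Y) → dPart Z ≋ lam (Z ⊱ cst b) →
    let X = (Y ⊛ ι W) ⊛ Z in
    dPart X ≋ ((((Y ⊱ W) ⊰ Z) ⊕ lam (X ⊱ cst b)) ⊕ lam (cst c ⊰ X))
  sandwich-fixpoint Y Z b c W dPart-Y dPart-Z = begin
      dPart ((Y ⊛ ι W) ⊛ Z)
    ≈⟨ dPart-⊛ (Y ⊛ ι W) Z ⟩
      (dPart (Y ⊛ ι W) ⊰ Z) ⊕ ((Y ⊛ ι W) ⊱ dPart Z)
    ≈⟨ ⊕-cong (⊰-congˡ Z (dPart-⊛ Y (ι W))) (⊱-congʳ (Y ⊛ ι W) dPart-Z) ⟩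
      (((dPart Y ⊰ ι W) ⊕ (Y ⊱ W)) ⊰ Z) ⊕ ((Y ⊛ ι W) ⊱ lam (Z ⊱ cst b))
    ≈⟨ ⊕-cong (⊰-distribʳ (dPart Y ⊰ ι W) (Y ⊱ W) Z) (⊱-lam-⊛ (Y ⊛ ι W) Z (cst b)) ⟩
      (((dPart Y ⊰ ι W) ⊰ Z) ⊕ ((Y ⊱ W) ⊰ Z)) ⊕ lam (((Y ⊛ ι W) ⊛ Z) ⊱ cst b)
    ≈⟨ (λ _ → xy∙z≈yz∙x _ _ _) ⟩
      (((Y ⊱ W) ⊰ Z) ⊕ lam (((Y ⊛ ι W) ⊛ Z) ⊱ cst b)) ⊕ ((dPart Y ⊰ ι W) ⊰ Z)
    ≈⟨ ⊕-cong (λ _ → ≈ᴹ-refl) left ⟩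
      (((Y ⊱ W) ⊰ Z) ⊕ lam (((Y ⊛ ι W) ⊛ Z) ⊱ cst b)) ⊕ lam (cst c ⊰ ((Y ⊛ ι W) ⊛ Z))
    ∎
    where
    left : ((dPart Y ⊰ ι W) ⊰ Z) ≋ lam (cst c ⊰ ((Y ⊛ ι W) ⊛ Z))
    left = begin
      (dPart Y ⊰ ι W) ⊰ Z          ≈⟨ ⊰-congˡ Z (⊰-congˡ (ι W) dPart-Y) ⟩
      (lam (cst c ⊰ Y) ⊰ ι W) ⊰ Z  ≈⟨ ⊰-congˡ Z (lam-⊰-⊛ (cst c) Y (ι W)) ⟩
      lam (cst c ⊰ (Y ⊛ ι W)) ⊰ Z  ≈⟨ lam-⊰-⊛ (cst c) (Y ⊛ ι W) Z ⟩
      lam (cst c ⊰ ((Y ⊛ ι W) ⊛ Z))  ∎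

mainTheorem3 : ∀ {κ ℓ m ℓm : Level} (F : Field κ ℓ) → CharZero F →
    (D : Dendriform F m ℓm) →
    let open Dendriform D using (Carrierᴹ) in
    let open Ops D in
    (a b c : Carrierᴹ) (Y Z Yinv Zinv : PS̄) →
    Y ≋̄ (one ⊕̄ lam̄ (ι (cst c ⊰ Y))) →
    Z ≋̄ (one ⊕̄ lam̄ (ι (Z ⊱ cst b))) →
    IsInverse Y Yinv →
    IsInverse Z Zinv →
    let X = (Y ⊛ ι ((Yinv ⊱ cst a) ⊰ Zinv)) ⊛ Z in
    X ≋̄ ι ((cst a ⊕ lam (X ⊱ cst b)) ⊕ lam (cst c ⊰ X))
mainTheorem3 F _ D a b c Y Z Yinv Zinv Y-eq Z-eq (YYinv≈1 , _) (_ , ZinvZ≈1) n =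
  ≈ᴹ-trans (sandwich-fixpoint Y Z b c W (dPart-one+lam _ Y-eq) (dPart-one+lam _ Z-eq) n)
           (+ᴹ-congʳ (+ᴹ-congʳ (conjugate-cancel Y Yinv Z Zinv YYinv≈1 ZinvZ≈1 (cst a) n))) ,
  ⊛-unitFreeˡ (Y ⊛ ι W) Z (⊛-unitFreeʳ Y (ι W) (λ _ → Field.refl F)) n
  where
  open Dendriform D using (≈ᴹ-trans; +ᴹ-congʳ)
  open Ops D
  open PowerSeries D
  W : PS
  W = (Yinv ⊱ cst a) ⊰ Zinv
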